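{- Fix an integer $d\ge1$, a real number $m$, and let $(\alpha,\beta,\gamma)$ be an admissible triple for $d,m$ with Catalan array $(f_{n,k})$. Let $1\le t\le 2d$ be an integer. The following are equivalent: (1) for all $1\le n\le t$: $f_{n,0}=0$ if $n$ is odd, and $f_{n,0}=\dfrac{m^n (n-1)!!}{\prod_{j=0}^{n/2-1}(m+2j)}$ (i.e. $\frac{m^n(n-1)!!(m-2)!!}{(m+n-2)!!}$) if $n$ is even; (2) for all integers $(n,k)$ with $0\le k\le n$ and $n+k\le t$: $f_{n,k}=0$ if $n\not\equiv k\pmod 2$, and $f_{n,k}=\dfrac{m^n\, n!}{(n-k)!!\prod_{j=0}^{(n+k)/2-1}(m+2j)}$ (i.e. $\frac{m^n n!(m-2)!!}{(n-k)!!(m+n+k-2)!!}$) if $n\equiv k\pmod 2$; (3) $a_i^*=0$ for $0\le i\le\lfloor (t-1)/2\rfloor$ and $c_j^*=\dfrac{mj}{m+2j-2}$ for $1\le j\le\lceil (t-1)/2\rceil$.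
   Context: A triple $\alpha=(a_i^*)_{0\le i\le d}$, $\beta=(b_i^*)_{0\le i\le d}$, $\gamma=(c_i^*)_{0\le i\le d}$ of non-negative real sequences is admissible (for $d,m$) if $\prod_{i=0}^{d-1}b_i^*c_{i+1}^*\neq 0$, $a_i^*+b_i^*+c_i^*=m$ for all $0\le i\le d$, $a_0^*=c_0^*=b_d^*=0$ and $c_1^*=1$. Its Catalan array $(f_{n,k})$ is defined for integers $n,k\ge0$ with $n+k\le 2d$ by $f_{0,0}=1$, $f_{0,k}=0$ for $k\ge1$, and $f_{n,k}=c_k^*f_{n-1,k-1}+a_k^*f_{n-1,k}+b_k^*f_{n-1,k+1}$ for $n\ge1$, with out-of-range terms equal to zero. Double factorials: $0!!=(-1)!!=1$; the ratio $(m-2)!!/(m+2r-2)!!$ is interpreted as $1/\prod_{j=0}^{r-1}(m+2j)$. -}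

module Defs where

open import Data.Nat as ℕ using (ℕ; zero; suc)
open import Data.Nat.Base using (_!)
open import Data.Product using (Σ; ∃; _×_; _,_)
open import Relation.Binary.PropositionalEquality using (_≡_; _≢_)
open import Relation.Nullary using (¬_)
open import Data.Sum using (_⊎_)

-- The real numbers, axiomatised as a complete ordered field
-- (any two models are isomorphic, so quantifying over all models
-- is the same as speaking about ℝ).
record RealField : Set₁ where
  infixl 6 _+_
  infixl 7 _*_
  infix 4 _≤_
  field
    R    : Set
    0ℝ 1ℝ : R
    _+_ _*_ : R → R → R
    -_   : R → R
    _⁻¹  : R → R          -- total inverse; only meaningful on nonzero arguments
    _≤_  : R → R → Set
    +-assoc : ∀ x y z → (x + y) + z ≡ x + (y + z)
    +-comm  : ∀ x y → x + y ≡ y + x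
    +-identityˡ : ∀ x → 0ℝ + x ≡ x
    +-inverseˡ  : ∀ x → (- x) + x ≡ 0ℝ
    *-assoc : ∀ x y z → (x * y) * z ≡ x * (y * z)
    *-comm  : ∀ x y → x * y ≡ y * x
    *-identityˡ : ∀ x → 1ℝ * x ≡ x
    *-inverseˡ  : ∀ x → x ≢ 0ℝ → (x ⁻¹) * x ≡ 1ℝ
    distribˡ : ∀ x y z → x * (y + z) ≡ x * y + x * z
    0≢1 : 0ℝ ≢ 1ℝ
    ≤-refl    : ∀ x → x ≤ x
    ≤-trans   : ∀ {x y z} → x ≤ y → y ≤ z → x ≤ z
    ≤-antisym : ∀ {x y} → x ≤ y → y ≤ x → x ≡ y
    ≤-total   : ∀ x y → (x ≤ y) ⊎ (y ≤ x)
    +-mono-≤  : ∀ {x y} z → x ≤ y → x + z ≤ y + z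
    *-nonneg  : ∀ {x y} → 0ℝ ≤ x → 0ℝ ≤ y → 0ℝ ≤ x * y
    sup : ∀ (P : R → Set) → (∃ λ x → P x) → (∃ λ u → ∀ x → P x → x ≤ u) →
          ∃ λ s → (∀ x → P x → x ≤ s) × (∀ u → (∀ x → P x → x ≤ u) → s ≤ u)

-- Double factorial on ℕ: 0!! = 1!! = 1, (n+2)!! = (n+2)·n!!.
-- (With truncated subtraction, (0 ∸ 1)!! = 0!! = 1 = (-1)!!.)
_!! : ℕ → ℕ
zero !! = 1
suc zero !! = 1
suc (suc n) !! = suc (suc n) ℕ.* (n !!)

module RF (ℝ : RealField) where
  open RealField ℝ public

  _-_ : R → R → R
  x - y = x + (- y)

  _/_ : R → R → R
  x / y = x * (y ⁻¹)

  ι : ℕ → R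
  ι zero = 0ℝ
  ι (suc n) = 1ℝ + ι n

  _^_ : R → ℕ → R
  x ^ zero = 1ℝ
  x ^ suc n = x * (x ^ n)

  prod : ℕ → (ℕ → R) → R
  prod zero g = 1ℝ
  prod (suc r) g = prod r g * g r

  -- (m-2)!!/(m+2r-2)!! is read as 1 / ∏_{j=0}^{r-1} (m+2j); this is that product
  risingEven : R → ℕ → R
  risingEven m r = prod r (λ j → m + ι (2 ℕ.* j))

  -- admissible triple (α,β,γ) = (a,b,c) for d, m
  record Admissible (d : ℕ) (m : R) (a b c : ℕ → R) : Set where
    field
      a-nonneg : ∀ i → i ℕ.≤ d → 0ℝ ≤ a i
      b-nonneg : ∀ i → i ℕ.≤ d → 0ℝ ≤ b i
      c-nonneg : ∀ i → i ℕ.≤ d → 0ℝ ≤ c i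
      prod-nonzero : prod d (λ i → b i * c (suc i)) ≢ 0ℝ
      row-sum : ∀ i → i ℕ.≤ d → a i + b i + c i ≡ m
      a₀ : a 0 ≡ 0ℝ
      c₀ : c 0 ≡ 0ℝ
      b-d : b d ≡ 0ℝ
      c₁ : c 1 ≡ 1ℝ

  -- Catalan array f_{n,k}; out-of-range (k-1 < 0) terms are zero.
  catalan : (a b c : ℕ → R) → ℕ → ℕ → R
  catalan a b c zero zero = 1ℝ
  catalan a b c zero (suc k) = 0ℝ
  catalan a b c (suc n) zero =
    a 0 * catalan a b c n 0 + b 0 * catalan a b c n 1
  catalan a b c (suc n) (suc k) =
    c (suc k) * catalan a b c n k + a (suc k) * catalan a b c n (suc k)
      + b (suc k) * catalan a b c n (suc (suc k))

  Cond1 : ℕ → R → (a b c : ℕ → R) → ℕ → Set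
  Cond1 d m a b c t = ∀ n → 1 ℕ.≤ n → n ℕ.≤ t →
      (∀ r → n ≡ suc (2 ℕ.* r) → catalan a b c n 0 ≡ 0ℝ)
    × (∀ r → n ≡ 2 ℕ.* r →
         catalan a b c n 0 ≡ ((m ^ n) * ι ((n ℕ.∸ 1) !!)) / risingEven m r)

  Cond2 : ℕ → R → (a b c : ℕ → R) → ℕ → Set
  Cond2 d m a b c t = ∀ n k → k ℕ.≤ n → n ℕ.+ k ℕ.≤ t →
      (∀ r → n ℕ.+ k ≡ suc (2 ℕ.* r) → catalan a b c n k ≡ 0ℝ)
    × (∀ r → n ℕ.+ k ≡ 2 ℕ.* r →
         catalan a b c n k ≡ ((m ^ n) * ι (n ℕ.!)) / (ι ((n ℕ.∸ k) !!) * risingEven m r))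

  Cond3 : ℕ → R → (a b c : ℕ → R) → ℕ → Set
  Cond3 d m a b c t =
      (∀ i → i ℕ.≤ ℕ.⌊ t ℕ.∸ 1 /2⌋ → a i ≡ 0ℝ)
    × (∀ j → 1 ℕ.≤ j → j ℕ.≤ ℕ.⌈ t ℕ.∸ 1 /2⌉ →
         c j ≡ (m * ι j) / (m + ι (2 ℕ.* j) - ι 2))

-- Let G be the Catalan array of the model triple â = 0, ĉ j = m j / (m + 2j - 2), b̂ j = m - ĉ j.
-- Checking the recurrence by induction shows that G has the closed form of (2) and, as â = 0,
-- vanishes when n + k is odd; its column k = 0 is the sequence of (1).
-- The entries f n k with n + k ≤ s involve only a i, b i with 2i < s and c j with 2j ≤ s, and the
-- row sums determine b from a and c. So (3), which says that a and c agree with the model up to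
-- s = t, gives f = G on n + k ≤ t, hence (2), which contains (1).
-- Conversely, let f n 0 = G n 0 for n ≤ t and let the parameters agree up to some s < t. Since
-- b j ≠ 0, the recurrence f (n+1) j = c j f n (j-1) + a j f n j + b j f n (j+1) can be solved for
-- f n (j+1), so f = G propagates from f (s+1) 0 up the antidiagonal n + k = s + 1. At its top it
-- reads a h G h h = 0 if s = 2h, and c (h+1) G h h = ĉ (h+1) G h h if s = 2h + 1; as G h h ≠ 0,
-- the agreement extends to s + 1.
module Submission where

open import Defs
open import Algebra.Bundles using (CommutativeRing)
open import Data.Nat as ℕ using (ℕ; zero; suc; NonZero; z≤n; s≤s)
import Data.Nat.Properties as ℕₚ
open import Data.Product using (∃-syntax; _×_; _,_; proj₁; proj₂)
open import Data.Sum using (_⊎_; inj₁; inj₂)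
open import Function using (_∘_)
open import Function.Bundles using (_⇔_; mk⇔)
open import Relation.Binary.PropositionalEquality
open import Relation.Nullary using (contradiction; yes; no)

module Parity where
  open import Data.Nat.Base using (_+_; _*_; _≤_; _<_; ⌊_/2⌋; ⌈_/2⌉)
  open import Data.Nat.Tactic.RingSolver using (solve)
  open import Data.List using (_∷_; [])

  even⊎odd : ∀ n → ∃[ h ] (n ≡ 2 * h ⊎ n ≡ suc (2 * h))
  even⊎odd zero = 0 , inj₁ refl
  even⊎odd (suc n) with even⊎odd n
  ... | h , inj₁ n≡2h = h , inj₂ (cong suc n≡2h)
  ... | h , inj₂ n≡1+2h = suc h , inj₁ (trans (cong suc n≡1+2h) (sym (ℕₚ.*-suc 2 h)))

  odd-pred : ∀ {m r} → 2 + m ≡ suc (2 * r) → ∃[ r′ ] m ≡ suc (2 * r′)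
  odd-pred {r = suc r′} eq = r′ , ℕₚ.suc-injective (ℕₚ.suc-injective (trans eq (cong suc (ℕₚ.*-suc 2 r′))))

  even-gap : ∀ {n k r} → k ≤ n → n + k ≡ 2 * r → ∃[ u ] n ≡ k + 2 * u × r ≡ k + u
  even-gap {n} {k} {r} k≤n n+k≡2r with even⊎odd (n ℕ.∸ k)
  ... | u , inj₁ n-k≡2u = u , n≡k+2u , ℕₚ.*-cancelˡ-≡ r (k + u) 2 (begin
      2 * r            ≡⟨ n+k≡2r ⟨
      n + k            ≡⟨ cong (_+ k) n≡k+2u ⟩
      k + 2 * u + k    ≡⟨ solve (k ∷ u ∷ []) ⟩
      2 * (k + u)      ∎)
    where
    open ≡-Reasoning
    n≡k+2u : n ≡ k + 2 * u
    n≡k+2u = trans (sym (ℕₚ.m+[n∸m]≡n k≤n)) (cong (k +_) n-k≡2u)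
  ... | u , inj₂ n-k≡1+2u = contradiction (begin
      2 * r                  ≡⟨ n+k≡2r ⟨
      n + k                  ≡⟨ cong (_+ k) n≡k+1+2u ⟩
      k + suc (2 * u) + k    ≡⟨ solve (k ∷ u ∷ []) ⟩
      suc (2 * (k + u))      ∎) (ℕₚ.even≢odd r (k + u))
    where
    open ≡-Reasoning
    n≡k+1+2u : n ≡ k + suc (2 * u)
    n≡k+1+2u = trans (sym (ℕₚ.m+[n∸m]≡n k≤n)) (cong (k +_) n-k≡1+2u)

  double≤+ : ∀ {j n} → j ≤ n → 2 * j ≤ n + j
  double≤+ {j} j≤n = ℕₚ.+-mono-≤ j≤n (ℕₚ.≤-reflexive (ℕₚ.+-identityʳ j))

  double<+ : ∀ {j n} → j < n → 2 * j < n + j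
  double<+ {j} j<n = ℕₚ.+-mono-≤ j<n (ℕₚ.≤-reflexive (ℕₚ.+-identityʳ j))

  ≤⌊/2⌋⇒double≤ : ∀ {i} n → i ≤ ⌊ n /2⌋ → 2 * i ≤ n
  ≤⌊/2⌋⇒double≤ {i} n i≤⌊n/2⌋ = begin
    2 * i                  ≤⟨ ℕₚ.*-monoʳ-≤ 2 i≤⌊n/2⌋ ⟩
    2 * ⌊ n /2⌋            ≡⟨ cong (⌊ n /2⌋ +_) (ℕₚ.+-identityʳ _) ⟩
    ⌊ n /2⌋ + ⌊ n /2⌋      ≤⟨ ℕₚ.+-monoʳ-≤ ⌊ n /2⌋ (ℕₚ.⌊n/2⌋≤⌈n/2⌉ n) ⟩
    ⌊ n /2⌋ + ⌈ n /2⌉      ≡⟨ ℕₚ.⌊n/2⌋+⌈n/2⌉≡n n ⟩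
    n                      ∎
    where open ℕₚ.≤-Reasoning

  double≤⇒≤⌊/2⌋ : ∀ {i n} → 2 * i ≤ n → i ≤ ⌊ n /2⌋
  double≤⇒≤⌊/2⌋ {i} {n} 2i≤n = begin
    i                      ≡⟨ ℕₚ.n≡⌊n+n/2⌋ i ⟩
    ⌊ i + i /2⌋            ≡⟨ cong (λ x → ⌊ i + x /2⌋) (ℕₚ.+-identityʳ i) ⟨
    ⌊ 2 * i /2⌋            ≤⟨ ℕₚ.⌊n/2⌋-mono 2i≤n ⟩
    ⌊ n /2⌋                ∎
    where open ℕₚ.≤-Reasoning

open Parity

module DoubleFactorial where
  open import Data.Nat.Base using (_*_; _∸_; _!)

  !!≢0 : ∀ n → NonZero (n !!)
  !!≢0 zero = _
  !!≢0 (suc zero) = _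
  !!≢0 (suc (suc n)) = ℕₚ.m*n≢0 (suc (suc n)) (n !!) {{_}} {{ !!≢0 n }}

  double!!-suc : ∀ u → (2 * suc u) !! ≡ suc (suc (2 * u)) * (2 * u) !!
  double!!-suc u = cong _!! (ℕₚ.*-suc 2 u)

  suc-!≡!!*!! : ∀ n → suc n ! ≡ suc n !! * n !!
  suc-!≡!!*!! zero = refl
  suc-!≡!!*!! (suc n) = begin
    suc (suc n) * suc n !               ≡⟨ cong (suc (suc n) *_) (suc-!≡!!*!! n) ⟩
    suc (suc n) * (suc n !! * n !!)     ≡⟨ cong (suc (suc n) *_) (ℕₚ.*-comm (suc n !!) (n !!)) ⟩
    suc (suc n) * (n !! * suc n !!)     ≡⟨ ℕₚ.*-assoc (suc (suc n)) (n !!) (suc n !!) ⟨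
    suc (suc n) * n !! * suc n !!       ∎
    where open ≡-Reasoning

  !≡!!*!! : ∀ n → n ! ≡ n !! * (n ∸ 1) !!
  !≡!!*!! zero = refl
  !≡!!*!! (suc n) = suc-!≡!!*!! n

open DoubleFactorial

module FieldProperties (ℝ : RealField) where
  open RF ℝ public

  +-identityʳ : ∀ x → x + 0ℝ ≡ x
  +-identityʳ x = trans (+-comm x 0ℝ) (+-identityˡ x)

  *-identityʳ : ∀ x → x * 1ℝ ≡ x
  *-identityʳ x = trans (*-comm x 1ℝ) (*-identityˡ x)

  +-inverseʳ : ∀ x → x + (- x) ≡ 0ℝ
  +-inverseʳ x = trans (+-comm x (- x)) (+-inverseˡ x)

  distribʳ : ∀ x y z → (y + z) * x ≡ y * x + z * x
  distribʳ x y z = trans (*-comm _ x) (trans (distribˡ x y z) (cong₂ _+_ (*-comm x y) (*-comm x z)))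

  commutativeRing : CommutativeRing _ _
  commutativeRing = record
    { Carrier = R ; _≈_ = _≡_ ; _+_ = _+_ ; _*_ = _*_ ; -_ = -_ ; 0# = 0ℝ ; 1# = 1ℝ
    ; isCommutativeRing = record
      { isRing = record
        { +-isAbelianGroup = record
          { isGroup = record
            { isMonoid = record
              { isSemigroup = record
                { isMagma = record { isEquivalence = isEquivalence ; ∙-cong = cong₂ _+_ }
                ; assoc = +-assoc }
              ; identity = +-identityˡ , +-identityʳ }
            ; inverse = +-inverseˡ , +-inverseʳ
            ; ⁻¹-cong = cong (-_) }
          ; comm = +-comm }
        ; *-cong = cong₂ _*_
        ; *-assoc = *-assoc
        ; *-identity = *-identityˡ , *-identityʳ
        ; distrib = distribˡ , distribʳ }
      ; *-comm = *-comm }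
    }

  open CommutativeRing commutativeRing public
    using (zeroˡ; zeroʳ; semiring; commutativeSemiring; +-group)
  open import Algebra.Properties.Ring (CommutativeRing.ring commutativeRing) public
    using (-‿distribˡ-*)
  open import Algebra.Properties.Group +-group public
    using (⁻¹-involutive; ε⁻¹≈ε; ∙-cancelˡ; x≈z//y; //-rightDividesˡ; //-rightDividesʳ)
  open import Algebra.Properties.Semiring.Mult semiring public
    using (×-homo-+; ×1-homo-*)
  open import Algebra.Definitions.RawMonoid (CommutativeRing.+-rawMonoid commutativeRing)
    using () renaming (_×_ to _×ℝ_)

  ι≗×1 : ∀ n → ι n ≡ n ×ℝ 1ℝ
  ι≗×1 zero = refl
  ι≗×1 (suc n) = cong (1ℝ +_) (ι≗×1 n)

  ι-homo-+ : ∀ m n → ι (m ℕ.+ n) ≡ ι m + ι n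
  ι-homo-+ m n = begin
    ι (m ℕ.+ n)            ≡⟨ ι≗×1 (m ℕ.+ n) ⟩
    (m ℕ.+ n) ×ℝ 1ℝ        ≡⟨ ×-homo-+ 1ℝ m n ⟩
    m ×ℝ 1ℝ + n ×ℝ 1ℝ      ≡⟨ cong₂ _+_ (ι≗×1 m) (ι≗×1 n) ⟨
    ι m + ι n              ∎
    where open ≡-Reasoning

  ι-homo-* : ∀ m n → ι (m ℕ.* n) ≡ ι m * ι n
  ι-homo-* m n = begin
    ι (m ℕ.* n)            ≡⟨ ι≗×1 (m ℕ.* n) ⟩
    (m ℕ.* n) ×ℝ 1ℝ        ≡⟨ ×1-homo-* m n ⟩
    m ×ℝ 1ℝ * n ×ℝ 1ℝ      ≡⟨ cong₂ _*_ (ι≗×1 m) (ι≗×1 n) ⟨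
    ι m * ι n              ∎
    where open ≡-Reasoning

  y≡0⇒x*y≡0 : ∀ {x y} → y ≡ 0ℝ → x * y ≡ 0ℝ
  y≡0⇒x*y≡0 {x} refl = zeroʳ x

  x≡0⇒x*y≡0 : ∀ {x y} → x ≡ 0ℝ → x * y ≡ 0ℝ
  x≡0⇒x*y≡0 {y = y} refl = zeroˡ y

  y≡0⇒x+y≡x : ∀ {x y} → y ≡ 0ℝ → x + y ≡ x
  y≡0⇒x+y≡x {x} refl = +-identityʳ x

  x≡0⇒x+y≡y : ∀ {x y} → x ≡ 0ℝ → x + y ≡ y
  x≡0⇒x+y≡y {y = y} refl = +-identityˡ y

  x≡0⇒y≡0⇒x+y≡0 : ∀ {x y} → x ≡ 0ℝ → y ≡ 0ℝ → x + y ≡ 0ℝ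
  x≡0⇒y≡0⇒x+y≡0 refl = y≡0⇒x+y≡x

  x*y≡z⇒x≡z/y : ∀ {x y z} → y ≢ 0ℝ → x * y ≡ z → x ≡ z / y
  x*y≡z⇒x≡z/y {x} {y} {z} y≢0 xy≡z = begin
    x                ≡⟨ *-identityʳ x ⟨
    x * 1ℝ           ≡⟨ cong (x *_) (trans (*-comm y _) (*-inverseˡ y y≢0)) ⟨
    x * (y * y ⁻¹)   ≡⟨ *-assoc x y _ ⟨
    x * y * y ⁻¹     ≡⟨ cong (_* y ⁻¹) xy≡z ⟩
    z / y            ∎
    where open ≡-Reasoning

  x/y*y≡x : ∀ {x y} → y ≢ 0ℝ → (x / y) * y ≡ x
  x/y*y≡x {x} {y} y≢0 = begin
    x * y ⁻¹ * y     ≡⟨ *-assoc x _ y ⟩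
    x * (y ⁻¹ * y)   ≡⟨ cong (x *_) (*-inverseˡ y y≢0) ⟩
    x * 1ℝ           ≡⟨ *-identityʳ x ⟩
    x                ∎
    where open ≡-Reasoning

  *-cancelʳ-≢0 : ∀ {x y z} → x ≢ 0ℝ → y * x ≡ z * x → y ≡ z
  *-cancelʳ-≢0 x≢0 yx≡zx = trans (x*y≡z⇒x≡z/y x≢0 yx≡zx) (sym (x*y≡z⇒x≡z/y x≢0 refl))

  *-≢0 : ∀ {x y} → x ≢ 0ℝ → y ≢ 0ℝ → x * y ≢ 0ℝ
  *-≢0 {x} {y} x≢0 y≢0 xy≡0 = x≢0 (*-cancelʳ-≢0 y≢0 (trans xy≡0 (sym (zeroˡ y))))

  x*y≡z≢0⇒x≢0 : ∀ {x y z} → x * y ≡ z → z ≢ 0ℝ → x ≢ 0ℝ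
  x*y≡z≢0⇒x≢0 {y = y} xy≡z z≢0 refl = z≢0 (trans (sym xy≡z) (zeroˡ y))

  x+y*z≡x+y*w⇒z≡w : ∀ {x y z w} → y ≢ 0ℝ → x + y * z ≡ x + y * w → z ≡ w
  x+y*z≡x+y*w⇒z≡w {x} {y} {z} {w} y≢0 eq =
    *-cancelʳ-≢0 y≢0 (trans (*-comm z y) (trans (∙-cancelˡ x (y * z) (y * w) eq) (*-comm y w)))

  1≢0 : 1ℝ ≢ 0ℝ
  1≢0 = 0≢1 ∘ sym

  prod≢0⇒≢0 : ∀ {r g i} → prod r g ≢ 0ℝ → i ℕ.< r → g i ≢ 0ℝ
  prod≢0⇒≢0 {suc r} ∏≢0 i<1+r gi≡0 with ℕₚ.m≤n⇒m<n∨m≡n (ℕₚ.≤-pred i<1+r)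
  ... | inj₁ i<r = prod≢0⇒≢0 (λ ∏≡0 → ∏≢0 (x≡0⇒x*y≡0 ∏≡0)) i<r gi≡0
  ... | inj₂ refl = ∏≢0 (y≡0⇒x*y≡0 gi≡0)

  prod-≢0 : ∀ r g → (∀ j → j ℕ.< r → g j ≢ 0ℝ) → prod r g ≢ 0ℝ
  prod-≢0 zero g _ = 1≢0
  prod-≢0 (suc r) g g≢0 = *-≢0 (prod-≢0 r g (λ j → g≢0 j ∘ ℕₚ.m<n⇒m<1+n)) (g≢0 r ℕₚ.≤-refl)

  0≤1 : 0ℝ ≤ 1ℝ
  0≤1 with ≤-total 0ℝ 1ℝ
  ... | inj₁ 0≤1 = 0≤1
  ... | inj₂ 1≤0 = contradiction (≤-antisym 0≤[-1]² 1≤0) 0≢1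
    where
    0≤-1 : 0ℝ ≤ - 1ℝ
    0≤-1 = subst₂ _≤_ (+-inverseʳ 1ℝ) (+-identityˡ (- 1ℝ)) (+-mono-≤ (- 1ℝ) 1≤0)
    [-1]²≡1 : - 1ℝ * - 1ℝ ≡ 1ℝ
    [-1]²≡1 = trans (sym (-‿distribˡ-* 1ℝ (- 1ℝ))) (trans (cong -_ (*-identityˡ (- 1ℝ))) (⁻¹-involutive 1ℝ))
    0≤[-1]² : 0ℝ ≤ 1ℝ
    0≤[-1]² = subst (0ℝ ≤_) [-1]²≡1 (*-nonneg 0≤-1 0≤-1)

  +-nonneg : ∀ {x y} → 0ℝ ≤ x → 0ℝ ≤ y → 0ℝ ≤ x + y
  +-nonneg {x} {y} 0≤x 0≤y = ≤-trans 0≤y (subst (_≤ x + y) (+-identityˡ y) (+-mono-≤ y 0≤x))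

  nonneg+pos≢0 : ∀ {x y} → 0ℝ ≤ x → 0ℝ ≤ y → y ≢ 0ℝ → x + y ≢ 0ℝ
  nonneg+pos≢0 {x} {y} 0≤x 0≤y y≢0 x+y≡0 =
    y≢0 (≤-antisym (subst₂ _≤_ (+-identityˡ y) x+y≡0 (+-mono-≤ y 0≤x)) 0≤y)

  ι-nonneg : ∀ n → 0ℝ ≤ ι n
  ι-nonneg zero = ≤-refl 0ℝ
  ι-nonneg (suc n) = +-nonneg 0≤1 (ι-nonneg n)

  ι-≢0 : ∀ n → .{{NonZero n}} → ι n ≢ 0ℝ
  ι-≢0 (suc n) 1+n≡0 = nonneg+pos≢0 (ι-nonneg n) 0≤1 1≢0 (trans (+-comm (ι n) 1ℝ) 1+n≡0)

module CatalanArray (ℝ : RealField) (a b c : ℕ → RF.R ℝ) where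
  open FieldProperties ℝ

  private
    f : ℕ → ℕ → R
    f = catalan a b c

  catalan-above-diagonal : ∀ n k → n ℕ.< k → f n k ≡ 0ℝ
  catalan-above-diagonal zero (suc k) _ = refl
  catalan-above-diagonal (suc n) (suc k) (s≤s n<k) =
    x≡0⇒y≡0⇒x+y≡0 (x≡0⇒y≡0⇒x+y≡0 (y≡0⇒x*y≡0 (catalan-above-diagonal n k n<k))
                                  (y≡0⇒x*y≡0 (catalan-above-diagonal n (suc k) n<k+1)))
                  (y≡0⇒x*y≡0 (catalan-above-diagonal n (suc (suc k)) (ℕₚ.m<n⇒m<1+n n<k+1)))
    where
    n<k+1 : n ℕ.< suc k
    n<k+1 = ℕₚ.m<n⇒m<1+n n<k

  catalan-diagonal : ∀ h → f (suc h) (suc h) ≡ c (suc h) * f h h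
  catalan-diagonal h =
    trans (y≡0⇒x+y≡x (y≡0⇒x*y≡0 (catalan-above-diagonal h (suc (suc h)) (ℕₚ.m<n⇒m<1+n ℕₚ.≤-refl))))
          (y≡0⇒x+y≡x (y≡0⇒x*y≡0 (catalan-above-diagonal h (suc h) ℕₚ.≤-refl)))

  catalan-subdiagonal : ∀ h →
    f (suc (suc h)) (suc h) ≡ c (suc h) * f (suc h) h + a (suc h) * f (suc h) (suc h)
  catalan-subdiagonal h = y≡0⇒x+y≡x (y≡0⇒x*y≡0 (catalan-above-diagonal (suc h) (suc (suc h)) ℕₚ.≤-refl))

  catalan-ac : ℕ → ℕ → R
  catalan-ac n zero = a 0 * f n 0
  catalan-ac n (suc k) = c (suc k) * f n k + a (suc k) * f n (suc k)

  catalan-suc : ∀ n k → f (suc n) k ≡ catalan-ac n k + b k * f n (suc k)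
  catalan-suc n zero = refl
  catalan-suc n (suc k) = refl

  catalan-odd-vanishes : (∀ i → a i ≡ 0ℝ) → ∀ n k r → n ℕ.+ k ≡ suc (2 ℕ.* r) → f n k ≡ 0ℝ
  catalan-odd-vanishes a≡0 zero (suc k) _ _ = refl
  catalan-odd-vanishes a≡0 (suc n) zero r n+1+0≡1+2r =
    x≡0⇒y≡0⇒x+y≡0 (x≡0⇒x*y≡0 (a≡0 0)) (y≡0⇒x*y≡0 (catalan-odd-vanishes a≡0 n 1 r n+1≡1+2r))
    where
    n+1≡1+2r : n ℕ.+ 1 ≡ suc (2 ℕ.* r)
    n+1≡1+2r = trans (ℕₚ.+-comm n 1) (trans (cong suc (sym (ℕₚ.+-identityʳ n))) n+1+0≡1+2r)
  catalan-odd-vanishes a≡0 (suc n) (suc k) r n+k+2≡1+2r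
    with odd-pred {r = r} (trans (cong suc (sym (ℕₚ.+-suc n k))) n+k+2≡1+2r)
  ... | r′ , n+k≡1+2r′ =
    x≡0⇒y≡0⇒x+y≡0 (x≡0⇒y≡0⇒x+y≡0 (y≡0⇒x*y≡0 (catalan-odd-vanishes a≡0 n k r′ n+k≡1+2r′))
                                  (x≡0⇒x*y≡0 (a≡0 (suc k))))
                  (y≡0⇒x*y≡0 (catalan-odd-vanishes a≡0 n (suc (suc k)) r
                                (trans (ℕₚ.+-suc n (suc k)) n+k+2≡1+2r)))

module CatalanComparison (ℝ : RealField) (a b c a′ b′ c′ : ℕ → RF.R ℝ) where
  open FieldProperties ℝ
  open CatalanArray ℝ a b c using (catalan-above-diagonal; catalan-ac; catalan-suc)
  open CatalanArray ℝ a′ b′ c′ using ()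
    renaming ( catalan-above-diagonal to catalan′-above-diagonal
             ; catalan-ac to catalan′-ac
             ; catalan-suc to catalan′-suc )

  private
    f f′ : ℕ → ℕ → R
    f = catalan a b c
    f′ = catalan a′ b′ c′

  record ParametersAgree (s : ℕ) : Set where
    field
      a-agree : ∀ i → 2 ℕ.* i ℕ.< s → a i ≡ a′ i
      b-agree : ∀ i → 2 ℕ.* i ℕ.< s → b i ≡ b′ i
      c-agree : ∀ j → 2 ℕ.* j ℕ.≤ s → c j ≡ c′ j

  weighted-entries-agree : ∀ n j {p p′} → (j ℕ.≤ n → p ≡ p′) → f n j ≡ f′ n j → p * f n j ≡ p′ * f′ n j
  weighted-entries-agree n j p≡p′ fnj≡f′nj with j ℕ.≤? n
  ... | yes j≤n = cong₂ _*_ (p≡p′ j≤n) fnj≡f′nj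
  ... | no j≰n = trans (y≡0⇒x*y≡0 (catalan-above-diagonal n j n<j))
                       (sym (y≡0⇒x*y≡0 (catalan′-above-diagonal n j n<j)))
    where
    n<j : n ℕ.< j
    n<j = ℕₚ.≰⇒> j≰n

  module _ {s} (agree : ParametersAgree s) where
    open ParametersAgree agree

    catalan-agree : ∀ n k → n ℕ.+ k ℕ.≤ s → f n k ≡ f′ n k
    catalan-agree zero zero _ = refl
    catalan-agree zero (suc k) _ = refl
    catalan-agree (suc n) zero n+1≤s =
      cong₂ _+_ (weighted-entries-agree n 0 (a-agree 0 ∘ index<) (entry 0 z≤n))
                (weighted-entries-agree n 1 (λ _ → b-agree 0 (index< z≤n)) (entry 1 ℕₚ.≤-refl))
      where
      index< : 0 ℕ.≤ n → 2 ℕ.* 0 ℕ.< s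
      index< 0≤n = ℕₚ.≤-trans (s≤s (double≤+ 0≤n)) n+1≤s
      entry : ∀ j → j ℕ.≤ 1 → f n j ≡ f′ n j
      entry j j≤1 = catalan-agree n j
        (ℕₚ.≤-trans (ℕₚ.+-monoʳ-≤ n j≤1) (ℕₚ.≤-trans (ℕₚ.≤-reflexive (ℕₚ.+-suc n 0)) n+1≤s))
    catalan-agree (suc n) (suc k) n+k+2≤s =
      cong₂ _+_ (cong₂ _+_ (weighted-entries-agree n k c-index (entry k (ℕₚ.m≤n⇒m≤1+n (ℕₚ.n≤1+n k))))
                           (weighted-entries-agree n (suc k) (a-agree (suc k) ∘ index<) (entry (suc k) (ℕₚ.n≤1+n _))))
                (weighted-entries-agree n (suc (suc k)) (b-agree (suc k) ∘ index< ∘ ℕₚ.≤-trans (ℕₚ.n≤1+n _))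
                                        (entry (suc (suc k)) ℕₚ.≤-refl))
      where
      c-index : k ℕ.≤ n → c (suc k) ≡ c′ (suc k)
      c-index k≤n = c-agree (suc k) (ℕₚ.≤-trans (double≤+ (s≤s k≤n)) n+k+2≤s)
      index< : suc k ℕ.≤ n → 2 ℕ.* suc k ℕ.< s
      index< k+1≤n = ℕₚ.≤-trans (s≤s (double≤+ k+1≤n)) n+k+2≤s
      entry : ∀ j → j ℕ.≤ suc (suc k) → f n j ≡ f′ n j
      entry j j≤k+2 = catalan-agree n j
        (ℕₚ.≤-trans (ℕₚ.+-monoʳ-≤ n j≤k+2)
                    (ℕₚ.≤-trans (ℕₚ.≤-reflexive (ℕₚ.+-suc n (suc k))) n+k+2≤s))

    catalan-ac-agree : ∀ n k → k ℕ.< n → n ℕ.+ k ℕ.≤ s → catalan-ac n k ≡ catalan′-ac n k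
    catalan-ac-agree n zero 0<n n+0≤s =
      cong₂ _*_ (a-agree 0 (ℕₚ.≤-trans (double<+ 0<n) n+0≤s)) (catalan-agree n 0 n+0≤s)
    catalan-ac-agree n (suc k) k+1<n n+k+1≤s =
      cong₂ _+_ (cong₂ _*_ (c-agree (suc k) (ℕₚ.≤-trans (ℕₚ.<⇒≤ (double<+ k+1<n)) n+k+1≤s))
                           (catalan-agree n k (ℕₚ.≤-trans (ℕₚ.+-monoʳ-≤ n (ℕₚ.n≤1+n k)) n+k+1≤s)))
                (cong₂ _*_ (a-agree (suc k) (ℕₚ.≤-trans (double<+ k+1<n) n+k+1≤s))
                           (catalan-agree n (suc k) n+k+1≤s))

    module _ (b≢0 : ∀ j → 2 ℕ.* suc j ℕ.≤ suc s → b j ≢ 0ℝ) (column : f (suc s) 0 ≡ f′ (suc s) 0) where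

      antidiagonal-agree : ∀ n j → j ℕ.≤ n → n ℕ.+ j ≡ suc s → f n j ≡ f′ n j
      antidiagonal-agree n zero _ n+0≡1+s =
        subst (λ n → f n 0 ≡ f′ n 0) (trans (sym n+0≡1+s) (ℕₚ.+-identityʳ n)) column
      antidiagonal-agree (suc n) (suc j) (s≤s j≤n) n+j+2≡s+1 = x+y*z≡x+y*w⇒z≡w (b≢0 j 2[j+1]≤s+1) (begin
        catalan-ac (suc n) j + b j * f (suc n) (suc j)      ≡⟨ catalan-suc (suc n) j ⟨
        f (suc (suc n)) j                                   ≡⟨ antidiagonal-agree (suc (suc n)) j j≤n+2 n+2+j≡s+1 ⟩
        f′ (suc (suc n)) j                                  ≡⟨ catalan′-suc (suc n) j ⟩
        catalan′-ac (suc n) j + b′ j * f′ (suc n) (suc j)   ≡⟨ cong₂ (λ x y → x + y * f′ (suc n) (suc j)) ac-agree b-agree′ ⟨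
        catalan-ac (suc n) j + b j * f′ (suc n) (suc j)     ∎)
        where
        open ≡-Reasoning
        j≤n+2 : j ℕ.≤ suc (suc n)
        j≤n+2 = ℕₚ.m≤n⇒m≤1+n (ℕₚ.m≤n⇒m≤1+n j≤n)
        n+2+j≡s+1 : suc (suc n) ℕ.+ j ≡ suc s
        n+2+j≡s+1 = trans (cong suc (sym (ℕₚ.+-suc n j))) n+j+2≡s+1
        n+1+j≡s : suc n ℕ.+ j ≡ s
        n+1+j≡s = ℕₚ.suc-injective n+2+j≡s+1
        2[j+1]≤s+1 : 2 ℕ.* suc j ℕ.≤ suc s
        2[j+1]≤s+1 = ℕₚ.≤-trans (double≤+ (s≤s j≤n)) (ℕₚ.≤-reflexive n+j+2≡s+1)
        ac-agree : catalan-ac (suc n) j ≡ catalan′-ac (suc n) j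
        ac-agree = catalan-ac-agree (suc n) j (s≤s j≤n) (ℕₚ.≤-reflexive n+1+j≡s)
        b-agree′ : b j ≡ b′ j
        b-agree′ = b-agree j (ℕₚ.≤-trans (double<+ (s≤s j≤n)) (ℕₚ.≤-reflexive n+1+j≡s))

module ModelTriple (ℝ : RealField) (m : RF.R ℝ) (0≤m : RF._≤_ ℝ (RF.0ℝ ℝ) m) (m≢0 : m ≢ RF.0ℝ ℝ) where
  open FieldProperties ℝ

  -- ĉ is spelled as in Cond3, where _-_ (no fixity declaration) binds tighter than _+_:
  -- the denominator is m + (2j - 2).
  â b̂ ĉ : ℕ → R
  â _ = 0ℝ
  ĉ j = (m * ι j) / (m + ι (2 ℕ.* j) - ι 2)
  b̂ j = m - ĉ j

  G : ℕ → ℕ → R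
  G = catalan â b̂ ĉ

  open CatalanArray ℝ â b̂ ĉ
  open import Algebra.Solver.Ring.NaturalCoefficients.Default commutativeSemiring
    using (solve; _:=_; _:+_; _:*_)

  m+ι≢0 : ∀ n → m + ι n ≢ 0ℝ
  m+ι≢0 n m+n≡0 = nonneg+pos≢0 (ι-nonneg n) 0≤m m≢0 (trans (+-comm (ι n) m) m+n≡0)

  ĉ-denominator : ∀ j → m + ι (2 ℕ.* suc j) - ι 2 ≡ m + ι (2 ℕ.* j)
  ĉ-denominator j = cong (m +_) (begin
    ι (2 ℕ.* suc j) - ι 2        ≡⟨ cong (λ n → ι n - ι 2) (trans (ℕₚ.*-suc 2 j) (ℕₚ.+-comm 2 (2 ℕ.* j))) ⟩
    ι (2 ℕ.* j ℕ.+ 2) - ι 2      ≡⟨ cong (_- ι 2) (ι-homo-+ (2 ℕ.* j) 2) ⟩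
    (ι (2 ℕ.* j) + ι 2) - ι 2    ≡⟨ //-rightDividesʳ (ι 2) (ι (2 ℕ.* j)) ⟩
    ι (2 ℕ.* j)                  ∎)
    where open ≡-Reasoning

  ĉ-suc : ∀ j → ĉ (suc j) * (m + ι (2 ℕ.* j)) ≡ m * ι (suc j)
  ĉ-suc j = trans (cong (ĉ (suc j) *_) (sym (ĉ-denominator j)))
                  (x/y*y≡x (subst (_≢ 0ℝ) (sym (ĉ-denominator j)) (m+ι≢0 (2 ℕ.* j))))

  ĉ-zero : ĉ 0 ≡ 0ℝ
  ĉ-zero = x≡0⇒x*y≡0 (zeroʳ m)

  b̂-zero : b̂ 0 ≡ m
  b̂-zero = trans (cong (λ x → m + - x) ĉ-zero) (trans (cong (m +_) ε⁻¹≈ε) (+-identityʳ m))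

  model-column : ∀ n → G (suc n) 0 ≡ m * G n 1
  model-column n = trans (x≡0⇒x+y≡y (zeroˡ (G n 0))) (cong (_* G n 1) b̂-zero)

  model-diagonal≢0 : ∀ h → G h h ≢ 0ℝ
  model-diagonal≢0 zero = 1≢0
  model-diagonal≢0 (suc h) = subst (_≢ 0ℝ) (sym (catalan-diagonal h)) (*-≢0 ĉ≢0 (model-diagonal≢0 h))
    where
    ĉ≢0 : ĉ (suc h) ≢ 0ℝ
    ĉ≢0 = x*y≡z≢0⇒x≢0 (ĉ-suc h) (*-≢0 m≢0 (ι-≢0 (suc h)))

  risingEven≢0 : ∀ r → risingEven m r ≢ 0ℝ
  risingEven≢0 r = prod-≢0 r _ (λ j _ → m+ι≢0 (2 ℕ.* j))

  mⁿn! : ℕ → R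
  mⁿn! n = m ^ n * ι (n ℕ.!)

  mⁿn!-suc : ∀ n → (m * ι (suc n)) * mⁿn! n ≡ mⁿn! (suc n)
  mⁿn!-suc n = begin
    (m * ι (suc n)) * (m ^ n * ι (n ℕ.!))
      ≡⟨ solve 4 (λ m x y z → (m :* x) :* (y :* z) := (m :* y) :* (x :* z)) refl m (ι (suc n)) (m ^ n) (ι (n ℕ.!)) ⟩
    (m * m ^ n) * (ι (suc n) * ι (n ℕ.!))
      ≡⟨ cong (m ^ suc n *_) (ι-homo-* (suc n) (n ℕ.!)) ⟨
    m ^ suc n * ι (suc n ℕ.!)   ∎
    where open ≡-Reasoning

  -- G n k = mⁿn! n / ((n ∸ k)!! · risingEven m r) for n = k + 2u and n + k = 2r, denominators cleared.
  ClosedForm : (n k u r : ℕ) → Set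
  ClosedForm n k u r = G n k * (ι ((2 ℕ.* u) !!) * risingEven m r) ≡ mⁿn! n

  closedForm-origin : ClosedForm 0 0 0 0
  closedForm-origin = cong (1ℝ *_) (*-identityʳ (ι 1))

  closedForm-column : ∀ u →
    ClosedForm (suc (2 ℕ.* u)) 1 u (suc u) → ClosedForm (suc (suc (2 ℕ.* u))) 0 (suc u) (suc u)
  closedForm-column u IH = begin
    G (suc N) 0 * (ι ((2 ℕ.* suc u) !!) * ρ)
      ≡⟨ cong₂ (λ x y → x * (y * ρ)) (model-column N)
               (trans (cong ι (double!!-suc u)) (ι-homo-* (suc N) ((2 ℕ.* u) !!))) ⟩
    m * G N 1 * (ι (suc N) * W * ρ)
      ≡⟨ solve 5 (λ m g x w r → m :* g :* (x :* w :* r) := (m :* x) :* (g :* (w :* r))) refl m (G N 1) (ι (suc N)) W ρ ⟩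
    m * ι (suc N) * (G N 1 * (W * ρ))   ≡⟨ cong (m * ι (suc N) *_) IH ⟩
    m * ι (suc N) * mⁿn! N              ≡⟨ mⁿn!-suc N ⟩
    mⁿn! (suc N)                        ∎
    where
    open ≡-Reasoning
    N : ℕ
    N = suc (2 ℕ.* u)
    W ρ : R
    W = ι ((2 ℕ.* u) !!)
    ρ = risingEven m (suc u)

  closedForm-diagonal : ∀ k → ClosedForm k k 0 k → ClosedForm (suc k) (suc k) 0 (suc k)
  closedForm-diagonal k IH = begin
    G (suc k) (suc k) * (ι 1 * (ρ * D))   ≡⟨ cong (_* (ι 1 * (ρ * D))) (catalan-diagonal k) ⟩
    ĉ (suc k) * G k k * (ι 1 * (ρ * D))
      ≡⟨ solve 5 (λ c g i r d → c :* g :* (i :* (r :* d)) := (c :* d) :* (g :* (i :* r)))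
                 refl (ĉ (suc k)) (G k k) (ι 1) ρ D ⟩
    ĉ (suc k) * D * (G k k * (ι 1 * ρ))   ≡⟨ cong₂ _*_ (ĉ-suc k) IH ⟩
    m * ι (suc k) * mⁿn! k                ≡⟨ mⁿn!-suc k ⟩
    mⁿn! (suc k)                          ∎
    where
    open ≡-Reasoning
    ρ D : R
    ρ = risingEven m k
    D = m + ι (2 ℕ.* k)

  interior-weights : ∀ k u →
    ĉ (suc k) * (m + ι (2 ℕ.* (k ℕ.+ suc u))) + b̂ (suc k) * ι (suc (suc (2 ℕ.* u))) ≡ m * ι (suc (k ℕ.+ 2 ℕ.* suc u))
  interior-weights k u = begin
    c * (m + ι (2 ℕ.* (k ℕ.+ suc u))) + b * V   ≡⟨ cong (λ e → c * e + b * V) E≡D+V ⟩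
    c * (D + V) + b * V
      ≡⟨ solve 4 (λ c d v b → c :* (d :+ v) :+ b :* v := c :* d :+ (b :+ c) :* v) refl c D V b ⟩
    c * D + (b + c) * V                         ≡⟨ cong₂ (λ x y → x + y * V) (ĉ-suc k) (//-rightDividesˡ c m) ⟩
    m * ι (suc k) + m * V                       ≡⟨ distribˡ m _ _ ⟨
    m * (ι (suc k) + V)                         ≡⟨ cong (m *_) (ι-homo-+ (suc k) (suc (suc (2 ℕ.* u)))) ⟨
    m * ι (suc k ℕ.+ suc (suc (2 ℕ.* u)))       ≡⟨ cong (λ n → m * ι (suc k ℕ.+ n)) (ℕₚ.*-suc 2 u) ⟨
    m * ι (suc (k ℕ.+ 2 ℕ.* suc u))             ∎
    where
    open ≡-Reasoning
    c b D V : R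
    c = ĉ (suc k)
    b = b̂ (suc k)
    D = m + ι (2 ℕ.* k)
    V = ι (suc (suc (2 ℕ.* u)))
    E≡D+V : m + ι (2 ℕ.* (k ℕ.+ suc u)) ≡ D + V
    E≡D+V = trans (cong (λ n → m + ι n) (trans (ℕₚ.*-distribˡ-+ 2 k (suc u)) (cong (2 ℕ.* k ℕ.+_) (ℕₚ.*-suc 2 u))))
                  (trans (cong (m +_) (ι-homo-+ (2 ℕ.* k) (suc (suc (2 ℕ.* u))))) (sym (+-assoc m _ _)))

  closedForm-interior : ∀ k u →
    ClosedForm (k ℕ.+ 2 ℕ.* suc u) k (suc u) (k ℕ.+ suc u) →
    ClosedForm (k ℕ.+ 2 ℕ.* suc u) (suc (suc k)) u (suc (k ℕ.+ suc u)) →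
    ClosedForm (suc (k ℕ.+ 2 ℕ.* suc u)) (suc k) (suc u) (suc (k ℕ.+ suc u))
  closedForm-interior k u IH₁ IH₂ = begin
    G (suc n) (suc k) * (ι ((2 ℕ.* suc u) !!) * (ρ * E))   ≡⟨ cong₂ (λ x y → x * (y * (ρ * E))) drop-â-term VW ⟩
    (c * G₁ + b * G₂) * (V * W * (ρ * E))
      ≡⟨ solve 8 (λ c g₁ b g₂ v w ρ e → (c :* g₁ :+ b :* g₂) :* (v :* w :* (ρ :* e))
                   := (c :* e) :* (g₁ :* (v :* w :* ρ)) :+ (b :* v) :* (g₂ :* (w :* (ρ :* e))))
                 refl c G₁ b G₂ V W ρ E ⟩
    (c * E) * (G₁ * (V * W * ρ)) + (b * V) * (G₂ * (W * (ρ * E)))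
      ≡⟨ cong₂ _+_ (cong (c * E *_) (trans (cong (λ x → G₁ * (x * ρ)) (sym VW)) IH₁))
                   (cong (b * V *_) IH₂) ⟩
    (c * E) * mⁿn! n + (b * V) * mⁿn! n    ≡⟨ distribʳ (mⁿn! n) _ _ ⟨
    (c * E + b * V) * mⁿn! n               ≡⟨ cong (_* mⁿn! n) (interior-weights k u) ⟩
    m * ι (suc n) * mⁿn! n                 ≡⟨ mⁿn!-suc n ⟩
    mⁿn! (suc n)                           ∎
    where
    open ≡-Reasoning
    n : ℕ
    n = k ℕ.+ 2 ℕ.* suc u
    c b G₁ G₂ V W ρ E : R
    c = ĉ (suc k)
    b = b̂ (suc k)
    G₁ = G n k
    G₂ = G n (suc (suc k))
    V = ι (suc (suc (2 ℕ.* u)))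
    W = ι ((2 ℕ.* u) !!)
    ρ = risingEven m (k ℕ.+ suc u)
    E = m + ι (2 ℕ.* (k ℕ.+ suc u))
    drop-â-term : G (suc n) (suc k) ≡ c * G₁ + b * G₂
    drop-â-term = cong (_+ b * G₂) (y≡0⇒x+y≡x (zeroˡ (G n (suc k))))
    VW : ι ((2 ℕ.* suc u) !!) ≡ V * W
    VW = trans (cong ι (double!!-suc u)) (ι-homo-* (suc (suc (2 ℕ.* u))) ((2 ℕ.* u) !!))

  -- Recursion on u, then on k: the last clause calls (k, u + 1) and (k + 2, u).
  closedForm : ∀ k u → ClosedForm (k ℕ.+ 2 ℕ.* u) k u (k ℕ.+ u)
  closedForm zero zero = closedForm-origin
  closedForm zero (suc u) =
    subst (λ n → ClosedForm n 0 (suc u) (suc u)) (sym (ℕₚ.*-suc 2 u)) (closedForm-column u (closedForm 1 u))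
  closedForm (suc k) zero =
    subst₂ (λ n r → ClosedForm n (suc k) 0 r) (cong suc k≡k+0) (cong suc k≡k+0)
      (closedForm-diagonal k (subst₂ (λ n r → ClosedForm n k 0 r) (sym k≡k+0) (sym k≡k+0) (closedForm k zero)))
    where
    k≡k+0 : k ≡ k ℕ.+ 0
    k≡k+0 = sym (ℕₚ.+-identityʳ k)
  closedForm (suc k) (suc u) =
    closedForm-interior k u (closedForm k (suc u))
      (subst₂ (λ n r → ClosedForm n (suc (suc k)) u r) k+2+2u≡k+2[u+1] (cong suc (sym (ℕₚ.+-suc k u)))
              (closedForm (suc (suc k)) u))
    where
    k+2+2u≡k+2[u+1] : suc (suc k) ℕ.+ 2 ℕ.* u ≡ k ℕ.+ 2 ℕ.* suc u
    k+2+2u≡k+2[u+1] = trans (sym (ℕₚ.+-assoc 2 k _)) (trans (cong (ℕ._+ 2 ℕ.* u) (ℕₚ.+-comm 2 k))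
                        (trans (ℕₚ.+-assoc k 2 _) (cong (k ℕ.+_) (sym (ℕₚ.*-suc 2 u)))))

  model-odd : ∀ n k r → n ℕ.+ k ≡ suc (2 ℕ.* r) → G n k ≡ 0ℝ
  model-odd = catalan-odd-vanishes (λ _ → refl)

  model-even : ∀ n k r → k ℕ.≤ n → n ℕ.+ k ≡ 2 ℕ.* r →
               G n k ≡ (m ^ n * ι (n ℕ.!)) / (ι ((n ℕ.∸ k) !!) * risingEven m r)
  model-even n k r k≤n n+k≡2r with even-gap {r = r} k≤n n+k≡2r
  ... | u , refl , refl = x*y≡z⇒x≡z/y (*-≢0 (ι-≢0 _ {{ !!≢0 (n ℕ.∸ k) }}) (risingEven≢0 r))
    (subst (λ g → G n k * (ι (g !!) * risingEven m r) ≡ mⁿn! n) (sym (ℕₚ.m+n∸m≡n k (2 ℕ.* u))) (closedForm k u))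

  model-column-even : ∀ r → G (2 ℕ.* r) 0 ≡ (m ^ (2 ℕ.* r) * ι ((2 ℕ.* r ℕ.∸ 1) !!)) / risingEven m r
  model-column-even r = x*y≡z⇒x≡z/y (risingEven≢0 r) (*-cancelʳ-≢0 (ι-≢0 (N !!) {{ !!≢0 N }}) (begin
    G N 0 * ρ * ι (N !!)
      ≡⟨ solve 3 (λ g ρ d → g :* ρ :* d := g :* (d :* ρ)) refl (G N 0) ρ (ι (N !!)) ⟩
    G N 0 * (ι (N !!) * ρ)                  ≡⟨ closedForm 0 r ⟩
    m ^ N * ι (N ℕ.!)                       ≡⟨ cong (λ x → m ^ N * ι x) (!≡!!*!! N) ⟩
    m ^ N * ι (N !! ℕ.* (N ℕ.∸ 1) !!)       ≡⟨ cong (m ^ N *_) (ι-homo-* (N !!) _) ⟩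
    m ^ N * (ι (N !!) * ι ((N ℕ.∸ 1) !!))
      ≡⟨ solve 3 (λ p d e → p :* (d :* e) := p :* e :* d) refl (m ^ N) (ι (N !!)) (ι ((N ℕ.∸ 1) !!)) ⟩
    m ^ N * ι ((N ℕ.∸ 1) !!) * ι (N !!)     ∎))
    where
    open ≡-Reasoning
    N : ℕ
    N = 2 ℕ.* r
    ρ : R
    ρ = risingEven m r

module Proposition (ℝ : RealField) (d : ℕ) (d≥1 : 1 ℕ.≤ d) (m : RF.R ℝ) (a b c : ℕ → RF.R ℝ)
                   (adm : RF.Admissible ℝ d m a b c) where
  open FieldProperties ℝ
  open Admissible adm

  private
    f : ℕ → ℕ → R
    f = catalan a b c

  b≢0 : ∀ i → i ℕ.< d → b i ≢ 0ℝ
  b≢0 i i<d bᵢ≡0 = prod≢0⇒≢0 prod-nonzero i<d (x≡0⇒x*y≡0 bᵢ≡0)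

  b₀≡m : b 0 ≡ m
  b₀≡m = trans (sym (trans (cong₂ _+_ (x≡0⇒x+y≡y a₀) c₀) (+-identityʳ (b 0)))) (row-sum 0 z≤n)

  0≤m : 0ℝ ≤ m
  0≤m = subst (0ℝ ≤_) b₀≡m (b-nonneg 0 z≤n)

  m≢0 : m ≢ 0ℝ
  m≢0 = subst (_≢ 0ℝ) b₀≡m (b≢0 0 d≥1)

  open ModelTriple ℝ m 0≤m m≢0
  open CatalanComparison ℝ a b c â b̂ ĉ
  open CatalanArray ℝ a b c using (catalan-diagonal; catalan-subdiagonal)
  module Model = CatalanArray ℝ â b̂ ĉ

  record AgreesWithModel (s : ℕ) : Set where
    field
      a-vanishes : ∀ i → 2 ℕ.* i ℕ.< s → a i ≡ 0ℝ
      c-agrees : ∀ j → 2 ℕ.* j ℕ.≤ s → c j ≡ ĉ j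

  ColumnAgrees : ℕ → Set
  ColumnAgrees t = ∀ n → n ℕ.≤ t → f n 0 ≡ G n 0

  parameters-agree : ∀ {s} → s ℕ.≤ 2 ℕ.* d → AgreesWithModel s → ParametersAgree s
  parameters-agree {s} s≤2d agrees = record
    { a-agree = a-vanishes
    ; b-agree = λ i 2i<s → x≈z//y (b i) (ĉ i) m (b+ĉ≡m i 2i<s)
    ; c-agree = c-agrees
    }
    where
    open AgreesWithModel agrees
    b+ĉ≡m : ∀ i → 2 ℕ.* i ℕ.< s → b i + ĉ i ≡ m
    b+ĉ≡m i 2i<s =
      trans (cong₂ _+_ (sym (x≡0⇒x+y≡y (a-vanishes i 2i<s))) (sym (c-agrees i (ℕₚ.<⇒≤ 2i<s))))
            (row-sum i (ℕₚ.*-cancelˡ-≤ 2 (ℕₚ.≤-trans (ℕₚ.<⇒≤ 2i<s) s≤2d)))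

  module _ {s} (1+s≤2d : suc s ℕ.≤ 2 ℕ.* d) (agrees : AgreesWithModel s) (column : f (suc s) 0 ≡ G (suc s) 0) where
    open AgreesWithModel agrees

    private
      params : ParametersAgree s
      params = parameters-agree (ℕₚ.≤-trans (ℕₚ.n≤1+n s) 1+s≤2d) agrees

      region : ∀ n k → n ℕ.+ k ℕ.≤ s → f n k ≡ G n k
      region = catalan-agree params

      antidiagonal : ∀ n j → j ℕ.≤ n → n ℕ.+ j ≡ suc s → f n j ≡ G n j
      antidiagonal = antidiagonal-agree params
        (λ j 2[j+1]≤1+s → b≢0 j (ℕₚ.*-cancelˡ-≤ 2 (ℕₚ.≤-trans 2[j+1]≤1+s 1+s≤2d))) column

    a-vanishes-new : ∀ h → 2 ℕ.* h ≡ s → a h ≡ 0ℝ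
    a-vanishes-new zero _ = a₀
    a-vanishes-new h@(suc h′) 2h≡s = *-cancelʳ-≢0 (model-diagonal≢0 h) (begin
      a h * G h h                   ≡⟨ cong (a h *_) (region h h (ℕₚ.≤-reflexive h+h≡s)) ⟨
      a h * f h h                   ≡⟨ x≡0⇒x+y≡y (y≡0⇒x*y≡0 fhh′≡0) ⟨
      c h * f h h′ + a h * f h h    ≡⟨ catalan-subdiagonal h′ ⟨
      f (suc h) h                   ≡⟨ antidiagonal (suc h) h (ℕₚ.n≤1+n h) (cong suc h+h≡s) ⟩
      G (suc h) h                   ≡⟨ model-odd (suc h) h h (cong suc h+h≡2h) ⟩
      0ℝ                            ≡⟨ zeroˡ (G h h) ⟨
      0ℝ * G h h                    ∎)
      where
      open ≡-Reasoning
      h+h≡2h : h ℕ.+ h ≡ 2 ℕ.* h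
      h+h≡2h = cong (h ℕ.+_) (sym (ℕₚ.+-identityʳ h))
      h+h≡s : h ℕ.+ h ≡ s
      h+h≡s = trans h+h≡2h 2h≡s
      fhh′≡0 : f h h′ ≡ 0ℝ
      fhh′≡0 = trans (region h h′ (ℕₚ.≤-trans (ℕₚ.+-monoʳ-≤ h (ℕₚ.n≤1+n h′)) (ℕₚ.≤-reflexive h+h≡s)))
                     (model-odd h h′ h′ (cong suc (cong (h′ ℕ.+_) (sym (ℕₚ.+-identityʳ h′)))))

    c-agrees-new : ∀ j → 2 ℕ.* j ≡ suc s → c j ≡ ĉ j
    c-agrees-new (suc h) 2[h+1]≡1+s = *-cancelʳ-≢0 (model-diagonal≢0 h) (begin
      c (suc h) * G h h      ≡⟨ cong (c (suc h) *_) (region h h h+h≤s) ⟨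
      c (suc h) * f h h      ≡⟨ catalan-diagonal h ⟨
      f (suc h) (suc h)      ≡⟨ antidiagonal (suc h) (suc h) ℕₚ.≤-refl h+1+h+1≡1+s ⟩
      G (suc h) (suc h)      ≡⟨ Model.catalan-diagonal h ⟩
      ĉ (suc h) * G h h      ∎)
      where
      open ≡-Reasoning
      h+1+h+1≡1+s : suc h ℕ.+ suc h ≡ suc s
      h+1+h+1≡1+s = trans (cong (suc h ℕ.+_) (sym (ℕₚ.+-identityʳ (suc h)))) 2[h+1]≡1+s
      1+2h≡s : suc (2 ℕ.* h) ≡ s
      1+2h≡s = ℕₚ.suc-injective (trans (sym (ℕₚ.*-suc 2 h)) 2[h+1]≡1+s)
      h+h≤s : h ℕ.+ h ℕ.≤ s
      h+h≤s = ℕₚ.≤-trans (ℕₚ.≤-reflexive (cong (h ℕ.+_) (sym (ℕₚ.+-identityʳ h))))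
                         (ℕₚ.≤-trans (ℕₚ.n≤1+n _) (ℕₚ.≤-reflexive 1+2h≡s))

    agrees-suc : AgreesWithModel (suc s)
    agrees-suc = record { a-vanishes = a-vanishes′ ; c-agrees = c-agrees′ }
      where
      a-vanishes′ : ∀ i → 2 ℕ.* i ℕ.< suc s → a i ≡ 0ℝ
      a-vanishes′ i 2i<1+s with ℕₚ.m≤n⇒m<n∨m≡n (ℕₚ.≤-pred 2i<1+s)
      ... | inj₁ 2i<s = a-vanishes i 2i<s
      ... | inj₂ 2i≡s = a-vanishes-new i 2i≡s
      c-agrees′ : ∀ j → 2 ℕ.* j ℕ.≤ suc s → c j ≡ ĉ j
      c-agrees′ j 2j≤1+s with ℕₚ.m≤n⇒m<n∨m≡n 2j≤1+s
      ... | inj₁ 2j<1+s = c-agrees j (ℕₚ.≤-pred 2j<1+s)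
      ... | inj₂ 2j≡1+s = c-agrees-new j 2j≡1+s

  column⇒agrees : ∀ t → t ℕ.≤ 2 ℕ.* d → ColumnAgrees t → AgreesWithModel t
  column⇒agrees zero _ _ = record { a-vanishes = λ _ () ; c-agrees = λ { zero _ → trans c₀ (sym ĉ-zero) } }
  column⇒agrees (suc s) 1+s≤2d column =
    agrees-suc 1+s≤2d
      (column⇒agrees s (ℕₚ.≤-trans (ℕₚ.n≤1+n s) 1+s≤2d) (λ n n≤s → column n (ℕₚ.m≤n⇒m≤1+n n≤s)))
      (column (suc s) ℕₚ.≤-refl)

  cond1⇒column : ∀ {t} → Cond1 d m a b c t → ColumnAgrees t
  cond1⇒column h n n≤t with even⊎odd n
  ... | zero , inj₁ refl = refl
  ... | r@(suc _) , inj₁ refl = trans (proj₂ (h (2 ℕ.* r) (s≤s z≤n) n≤t) r refl) (sym (model-column-even r))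
  ... | r , inj₂ refl = trans (proj₁ (h _ (s≤s z≤n) n≤t) r refl) (sym (model-odd _ 0 r (ℕₚ.+-identityʳ _)))

  column⇒cond1 : ∀ {t} → ColumnAgrees t → Cond1 d m a b c t
  column⇒cond1 column n _ n≤t =
    (λ r n≡1+2r → trans (column n n≤t) (model-odd n 0 r (trans (ℕₚ.+-identityʳ n) n≡1+2r))) ,
    (λ { r refl → trans (column _ n≤t) (model-column-even r) })

  cond1⇒agrees : ∀ {t} → t ℕ.≤ 2 ℕ.* d → Cond1 d m a b c t → AgreesWithModel t
  cond1⇒agrees {t} t≤2d = column⇒agrees t t≤2d ∘ cond1⇒column

  region⇒cond2 : ∀ {t} → (∀ n k → n ℕ.+ k ℕ.≤ t → f n k ≡ G n k) → Cond2 d m a b c t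
  region⇒cond2 region n k k≤n n+k≤t =
    (λ r odd → trans (region n k n+k≤t) (model-odd n k r odd)) ,
    (λ r even → trans (region n k n+k≤t) (model-even n k r k≤n even))

  agrees⇒cond2 : ∀ {t} → t ℕ.≤ 2 ℕ.* d → AgreesWithModel t → Cond2 d m a b c t
  agrees⇒cond2 t≤2d = region⇒cond2 ∘ catalan-agree ∘ parameters-agree t≤2d

  cond2⇒column : ∀ {t} → Cond2 d m a b c t → ColumnAgrees t
  cond2⇒column h n n≤t
    with even⊎odd (n ℕ.+ 0) | h n 0 z≤n (ℕₚ.≤-trans (ℕₚ.≤-reflexive (ℕₚ.+-identityʳ n)) n≤t)
  ... | r , inj₁ even | _ , formula = trans (formula r even) (sym (model-even n 0 r z≤n even))
  ... | r , inj₂ odd | vanishes , _ = trans (vanishes r odd) (sym (model-odd n 0 r odd))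

  cond3⇒agrees : ∀ {t} → 1 ℕ.≤ t → Cond3 d m a b c t → AgreesWithModel t
  cond3⇒agrees {suc t′} _ (a≡0 , c≡ĉ) = record
    { a-vanishes = λ i 2i<t → a≡0 i (double≤⇒≤⌊/2⌋ (ℕₚ.≤-pred 2i<t))
    ; c-agrees = λ { zero _ → trans c₀ (sym ĉ-zero)
                   ; (suc j) 2j≤t → c≡ĉ (suc j) (s≤s z≤n) (double≤⇒≤⌊/2⌋ 2j≤t) }
    }

  agrees⇒cond3 : ∀ {t} → 1 ℕ.≤ t → AgreesWithModel t → Cond3 d m a b c t
  agrees⇒cond3 {suc t′} _ agrees =
    (λ i i≤⌊t′/2⌋ → a-vanishes i (s≤s (≤⌊/2⌋⇒double≤ t′ i≤⌊t′/2⌋))) ,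
    (λ j _ j≤⌈t′/2⌉ → c-agrees j (≤⌊/2⌋⇒double≤ (suc t′) j≤⌈t′/2⌉))
    where open AgreesWithModel agrees

proposition2p3 : (ℝ : RealField) →
    (d : ℕ) → 1 ℕ.≤ d → (m : RF.R ℝ) (a b c : ℕ → RF.R ℝ) → RF.Admissible ℝ d m a b c →
    (t : ℕ) → 1 ℕ.≤ t → t ℕ.≤ 2 ℕ.* d →
    (RF.Cond1 ℝ d m a b c t ⇔ RF.Cond2 ℝ d m a b c t)
      × (RF.Cond1 ℝ d m a b c t ⇔ RF.Cond3 ℝ d m a b c t)
proposition2p3 ℝ d d≥1 m a b c adm t 1≤t t≤2d =
    mk⇔ (agrees⇒cond2 t≤2d ∘ cond1⇒agrees t≤2d) (column⇒cond1 ∘ cond2⇒column)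
  , mk⇔ (agrees⇒cond3 1≤t ∘ cond1⇒agrees t≤2d)
        (column⇒cond1 ∘ cond2⇒column ∘ agrees⇒cond2 t≤2d ∘ cond3⇒agrees 1≤t)
  where open Proposition ℝ d d≥1 m a b c adm
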